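{- Let $\mathcal{M}_\cup$ be an $L_\cup$-structure and let $\dim$ be an ordinal rank on $\mathcal{M}_\cap$. Suppose $J\subseteq I$ is finite and $X_i\subseteq M^x$ is $\mathcal{M}_i$-definable for all $i\in J$. If there is a nonempty $\mathcal{M}_\cap$-definable set $X$ in which each $X_i$ is pseudo-dense, then $(X_i)_{i\in J}$ is not separated. The converse implication (if $(X_i)_{i\in J}$ is not separated, then there is a nonempty $\mathcal{M}_\cap$-definable set in which each $X_i$ is pseudo-dense) holds provided $\mathcal{M}_i$ is approximable over $\mathcal{M}_\cap$ for all $i\in J$.
   Context: Languages $L_\cap$ and $L_i$ ($i\in I$) share the same sorts, $L_i\cap L_j=L_\cap$ for distinct $i,j$, and $L_\cup=\bigcup_i L_i$. For an $L_\cup$-structure $\mathcal{M}_\cup$, $\mathcal{M}_\square$ is its $L_\square$-reduct; definable means definable with parameters. A finite family $(X_i)_{i\in J}$ with $X_i\subseteq M^x$ $\mathcal{M}_i$-definable is separated if there are $\mathcal{M}_\cap$-definable $X^i\supseteq X_i$ ($i\in J$) with $\bigcap_{i\in J}X^i=\emptyset$. An ordinal rank on a structure $\mathcal{M}$ is a function $\dim$ assigning to each $\mathcal{M}$-definable set an ordinal or $-\infty$ such that for all definable $X,X'\subseteq M^x$: $\dim(X\cup X')=\max\{\dim X,\dim X'\}$; $\dim X=-\infty$ iff $X=\emptyset$; $\dim X=0$ iff $X$ is nonempty and finite. For $\mathcal{M}_\cap$-definable $X\subseteq M^x$ and arbitrary $A\subseteq M^x$, $A$ is pseudo-dense in $X$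 if $A$ meets every nonempty $\mathcal{M}_\cap$-definable $X'\subseteq X$ with $\dim X'=\dim X$; $X$ is a pseudo-closure of $A$ if $A\subseteq X$ and $A$ is pseudo-dense in $X$. $\mathcal{M}_i$ is approximable over $\mathcal{M}_\cap$ if every $\mathcal{M}_i$-definable set has an $\mathcal{M}_\cap$-definable pseudo-closure. -}

module Defs where

open import Level using (0ℓ)
open import Data.Unit using (⊤)
open import Data.Empty using (⊥)
open import Data.Product using (Σ; _×_; _,_; ∃)
open import Data.Sum using (_⊎_)
open import Data.Maybe using (Maybe; just; nothing)
open import Data.List using (List; []; _∷_; _++_)
open import Data.List.Relation.Unary.All using (All; []; _∷_; lookup)
open import Data.List.Membership.Propositional using (_∈_)
open import Relation.Nullary using (¬_)
open import Relation.Binary using (IsStrictTotalOrder; Tri; tri<; tri≈; tri>)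
open import Relation.Binary.PropositionalEquality using (_≡_)
open import Induction.WellFounded using (WellFounded)

-- Languages L_∩ ⊆ L_i ⊆ L_∪ (i ∈ I), sharing the same sorts.
-- Every symbol of L_∪ has an "owner": nothing means it lies in L_∩,
-- just i means it lies in L_i only.  Then L_i = L_∩ ∪ {owned by i},
-- L_i ∩ L_j = L_∩ for i ≠ j, and L_∪ = ⋃ L_i.

record Signature : Set₁ where
  field
    I        : Set
    Sort     : Set
    Fun      : Set
    Rel      : Set
    funArgs  : Fun → List Sort
    funRes   : Fun → Sort
    relArgs  : Rel → List Sort
    funOwner : Fun → Maybe I
    relOwner : Rel → Maybe I

record Fragment (Σ′ : Signature) : Set₁ where
  open Signature Σ′
  field
    hasFun : Fun → Set
    hasRel : Rel → Set

module _ (Σ′ : Signature) where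
  open Signature Σ′

  L∩ : Fragment Σ′
  L∩ = record { hasFun = λ f → funOwner f ≡ nothing
              ; hasRel = λ r → relOwner r ≡ nothing }

  Lᵢ : I → Fragment Σ′
  Lᵢ i = record { hasFun = λ f → funOwner f ≡ nothing ⊎ funOwner f ≡ just i
                ; hasRel = λ r → relOwner r ≡ nothing ⊎ relOwner r ≡ just i }

module Syntax {Σ′ : Signature} (P : Fragment Σ′) where
  open Signature Σ′
  open Fragment P

  mutual
    data Term (Γ : List Sort) : Sort → Set where
      var : ∀ {s} → s ∈ Γ → Term Γ s
      app : (f : Fun) → hasFun f → Terms Γ (funArgs f) → Term Γ (funRes f)

    data Terms (Γ : List Sort) : List Sort → Set where
      []  : Terms Γ []
      _∷_ : ∀ {s ss} → Term Γ s → Terms Γ ss → Terms Γ (s ∷ ss)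

  data Formula (Γ : List Sort) : Set where
    ⊤′ ⊥′      : Formula Γ
    _≐_        : ∀ {s} → Term Γ s → Term Γ s → Formula Γ
    rel        : (r : Rel) → hasRel r → Terms Γ (relArgs r) → Formula Γ
    ¬′_        : Formula Γ → Formula Γ
    _∧′_ _∨′_ _⇒′_ : Formula Γ → Formula Γ → Formula Γ
    ∃′ ∀′      : (s : Sort) → Formula (s ∷ Γ) → Formula Γ

record Structure (Σ′ : Signature) : Set₁ where
  open Signature Σ′
  field
    Carrier : Sort → Set
    funI    : (f : Fun) → All Carrier (funArgs f) → Carrier (funRes f)
    relI    : (r : Rel) → All Carrier (relArgs r) → Set

module _ {Σ′ : Signature} (M : Structure Σ′) where
  open Signature Σ′
  open Structure M

  Tuple : List Sort → Set
  Tuple xs = All Carrier xs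

  append : ∀ {xs ys} → Tuple xs → Tuple ys → Tuple (xs ++ ys)
  append []       b = b
  append (a ∷ as) b = a ∷ append as b

  module Sem (P : Fragment Σ′) where
    open Syntax P

    mutual
      evalT : ∀ {Γ s} → Term Γ s → Tuple Γ → Carrier s
      evalT (var x)      ρ = lookup ρ x
      evalT (app f _ ts) ρ = funI f (evalTs ts ρ)

      evalTs : ∀ {Γ ss} → Terms Γ ss → Tuple Γ → Tuple ss
      evalTs []       ρ = []
      evalTs (t ∷ ts) ρ = evalT t ρ ∷ evalTs ts ρ

    Sat : ∀ {Γ} → Formula Γ → Tuple Γ → Set
    Sat ⊤′          ρ = ⊤
    Sat ⊥′          ρ = ⊥
    Sat (t ≐ u)     ρ = evalT t ρ ≡ evalT u ρ
    Sat (rel r _ ts) ρ = relI r (evalTs ts ρ)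
    Sat (¬′ φ)      ρ = ¬ Sat φ ρ
    Sat (φ ∧′ ψ)    ρ = Sat φ ρ × Sat ψ ρ
    Sat (φ ∨′ ψ)    ρ = Sat φ ρ ⊎ Sat ψ ρ
    Sat (φ ⇒′ ψ)    ρ = Sat φ ρ → Sat ψ ρ
    Sat (∃′ s φ)    ρ = Σ (Carrier s) λ a → Sat φ (a ∷ ρ)
    Sat (∀′ s φ)    ρ = (a : Carrier s) → Sat φ (a ∷ ρ)

  SubsetOf : List Sort → Set₁
  SubsetOf xs = Tuple xs → Set

  Definable : Fragment Σ′ → (xs : List Sort) → SubsetOf xs → Set
  Definable P xs X =
    Σ (List Sort) λ ps → Σ (Tuple ps) λ b → Σ (Syntax.Formula P (xs ++ ps)) λ φ →
      (a : Tuple xs) → (X a → Sem.Sat P φ (append a b)) × (Sem.Sat P φ (append a b) → X a)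

  Def∩ : (xs : List Sort) → SubsetOf xs → Set
  Def∩ = Definable (L∩ Σ′)

  Defᵢ : I → (xs : List Sort) → SubsetOf xs → Set
  Defᵢ i = Definable (Lᵢ Σ′ i)

  _⊆_ : ∀ {xs} → SubsetOf xs → SubsetOf xs → Set
  X ⊆ Y = ∀ a → X a → Y a

  _∪_ : ∀ {xs} → SubsetOf xs → SubsetOf xs → SubsetOf xs
  (X ∪ Y) a = X a ⊎ Y a

  Empty : ∀ {xs} → SubsetOf xs → Set
  Empty X = ∀ a → ¬ X a

  Nonempty : ∀ {xs} → SubsetOf xs → Set
  Nonempty X = ∃ λ a → X a

  Finite : ∀ {xs} → SubsetOf xs → Set
  Finite {xs} X = Σ (List (Tuple xs)) λ l → ∀ a → X a → a ∈ l

-- Maximum in O ∪ {-∞} (nothing = -∞, the least element).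

maxWith : {O : Set} {_<_ : O → O → Set} →
          (∀ x y → Tri (x < y) (x ≡ y) (y < x)) → Maybe O → Maybe O → Maybe O
maxWith cmp nothing  m        = m
maxWith cmp (just x) nothing  = just x
maxWith cmp (just x) (just y) with cmp x y
... | tri< _ _ _ = just y
... | tri≈ _ _ _ = just x
... | tri> _ _ _ = just x

-- The ordinal values are taken in a well-ordered
-- type (O, <) (strict total order that is well-founded), i.e. an ordinal
-- up to isomorphism; -∞ is `nothing`; the ordinal 0 is the least element.

record OrdinalRank {Σ′ : Signature} (M : Structure Σ′) : Set₁ where
  open Signature Σ′
  field
    O      : Set
    _<_    : O → O → Set
    isSTO  : IsStrictTotalOrder _≡_ _<_
    wf     : WellFounded _<_
    dim    : ∀ {xs} (X : SubsetOf M xs) → Def∩ M xs X → Maybe O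

  cmp : ∀ x y → Tri (x < y) (x ≡ y) (y < x)
  cmp = IsStrictTotalOrder.compare isSTO

  IsZero : Maybe O → Set
  IsZero d = Σ O λ o → d ≡ just o × (∀ o′ → ¬ (o′ < o))

  field
    -- dim depends only on the set, not on the chosen defining formula
    dim-ext : ∀ {xs} (X Y : SubsetOf M xs) (dX : Def∩ M xs X) (dY : Def∩ M xs Y) →
              (∀ a → (X a → Y a) × (Y a → X a)) → dim X dX ≡ dim Y dY
    dim-∪   : ∀ {xs} (X Y : SubsetOf M xs) (dX : Def∩ M xs X) (dY : Def∩ M xs Y)
              (dXY : Def∩ M xs (_∪_ M X Y)) →
              dim (_∪_ M X Y) dXY ≡ maxWith cmp (dim X dX) (dim Y dY)
    dim-−∞  : ∀ {xs} (X : SubsetOf M xs) (dX : Def∩ M xs X) →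
              (dim X dX ≡ nothing → Empty M X) × (Empty M X → dim X dX ≡ nothing)
    dim-0   : ∀ {xs} (X : SubsetOf M xs) (dX : Def∩ M xs X) →
              (IsZero (dim X dX) → Nonempty M X × Finite M X) ×
              (Nonempty M X × Finite M X → IsZero (dim X dX))

module _ {Σ′ : Signature} {M : Structure Σ′} (R : OrdinalRank M) where
  open Signature Σ′
  open OrdinalRank R

  PseudoDense : ∀ {xs} (A : SubsetOf M xs) (X : SubsetOf M xs) → Def∩ M xs X → Set₁
  PseudoDense {xs} A X dX =
    (X′ : SubsetOf M xs) (dX′ : Def∩ M xs X′) →
    _⊆_ M X′ X → Nonempty M X′ → dim X′ dX′ ≡ dim X dX →
    ∃ λ a → A a × X′ a

  PseudoClosure : ∀ {xs} (A : SubsetOf M xs) (X : SubsetOf M xs) → Def∩ M xs X → Set₁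
  PseudoClosure A X dX = _⊆_ M A X × PseudoDense A X dX

  Approximable : I → Set₁
  Approximable i =
    ∀ {xs} (A : SubsetOf M xs) → Defᵢ M i xs A →
    Σ (SubsetOf M xs) λ X → Σ (Def∩ M xs X) λ dX → PseudoClosure A X dX

module _ {Σ′ : Signature} (M : Structure Σ′) where
  open Signature Σ′

  Separated : ∀ {xs} (J : List I) → (I → SubsetOf M xs) → Set₁
  Separated {xs} J X =
    Σ (I → SubsetOf M xs) λ Y →
      (∀ i → i ∈ J → Def∩ M xs (Y i)) ×
      (∀ i → i ∈ J → _⊆_ M (X i) (Y i)) ×
      Empty M (λ a → ∀ i → i ∈ J → Y i a)

-- Forward direction: if every X i is pseudo-dense in a nonempty M∩-definable Y and the
-- M∩-definable sets S i ⊇ X i separated them, then intersecting Y with the S i one at a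
-- time never lowers the rank (what is removed misses X i, and a set missing a set that
-- is pseudo-dense in Y has rank different from that of Y), so Y ∩ ⋂ S i would have the
-- rank of Y although it is empty.
--
-- Converse: call an M∩-definable Z bad if the traces X i ∩ Z cannot be separated inside
-- Z.  Given a bad Z, let C be Z intersected with M∩-definable pseudo-closures of the
-- X i ∩ Z.  A separation inside C extends to one inside Z (use the pseudo-closures outside
-- C), so C is again bad, hence nonempty, and its rank is at most that of Z.  By
-- well-foundedness of the ranks some bad Z has C of the same rank, and that C is a
-- nonempty set in which every X i is pseudo-dense.

module Submission where

open import Defs
open import Level using (0ℓ)
open import Data.Product using (Σ; _×_; _,_; proj₁; proj₂)
open import Data.Sum using (_⊎_; inj₁; inj₂)
open import Data.Unit using (⊤; tt)
open import Data.Empty using (⊥-elim)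
open import Data.Maybe using (just; nothing)
open import Data.List using (List; []; _∷_; _++_)
open import Data.List.Relation.Unary.All using (All; []; _∷_; lookup; tabulate)
open import Data.List.Relation.Unary.Any using (here; there)
open import Data.List.Relation.Unary.Any.Properties using (++⁺ˡ; ++⁺ʳ)
open import Data.List.Membership.Propositional using (_∈_)
open import Data.Product.Function.NonDependent.Propositional using (_×-⇔_)
open import Data.Sum.Function.Propositional using (_⊎-⇔_)
open import Function.Bundles using (_⇔_; mk⇔; Equivalence)
import Function.Properties.Equivalence as ⇔
open import Function.Related.TypeIsomorphisms using (→-cong-⇔; ¬-cong-⇔)
open import Relation.Nullary using (¬_; Dec; yes; no)
open import Relation.Binary using (IsStrictTotalOrder; IsPartialOrder; tri<; tri≈; tri>)
open import Relation.Binary.PropositionalEquality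
  using (_≡_; _≢_; refl; sym; trans; cong; cong₂; subst; subst₂)
open import Induction.WellFounded using (Acc; acc)
open import Axiom.ExcludedMiddle using (ExcludedMiddle)

open Equivalence using (to; from)

⇔⇒pair : {A B : Set} → A ⇔ B → (A → B) × (B → A)
⇔⇒pair e = to e , from e

pair⇒⇔ : {A B : Set} → (A → B) × (B → A) → A ⇔ B
pair⇒⇔ (f , g) = mk⇔ f g

Ren : {A : Set} → List A → List A → Set
Ren Γ Δ = ∀ {s} → s ∈ Γ → s ∈ Δ

lift : ∀ {A : Set} {Γ Δ : List A} {s} → Ren Γ Δ → Ren (s ∷ Γ) (s ∷ Δ)
lift r (here p)  = here p
lift r (there x) = there (r x)

lift* : ∀ {A : Set} (xs : List A) {Γ Δ : List A} → Ren Γ Δ → Ren (xs ++ Γ) (xs ++ Δ)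
lift* []       r = r
lift* (_ ∷ xs) r = lift (lift* xs r)

module SetOperations {Σ′ : Signature} (M : Structure Σ′) (xs : List (Signature.Sort Σ′)) where

  infixr 7 _∩_ _∖_

  _∩_ : SubsetOf M xs → SubsetOf M xs → SubsetOf M xs
  (A ∩ B) a = A a × B a

  _∖_ : SubsetOf M xs → SubsetOf M xs → SubsetOf M xs
  (A ∖ B) a = A a × ¬ B a

  ⋂ : {ι : Set} → List ι → (ι → SubsetOf M xs) → SubsetOf M xs
  ⋂ K S a = ∀ i → i ∈ K → S i a

module _ {Σ′ : Signature} where
  open Signature Σ′

  record _⊑_ (P Q : Fragment Σ′) : Set where
    field
      funs : ∀ f → Fragment.hasFun P f → Fragment.hasFun Q f
      rels : ∀ r → Fragment.hasRel P r → Fragment.hasRel Q r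

  ⊑-refl : ∀ {P} → P ⊑ P
  ⊑-refl = record { funs = λ _ h → h ; rels = λ _ h → h }

  L∩⊑Lᵢ : ∀ i → L∩ Σ′ ⊑ Lᵢ Σ′ i
  L∩⊑Lᵢ i = record { funs = λ _ → inj₁ ; rels = λ _ → inj₁ }

  module _ (M : Structure Σ′) where

    Agree : ∀ {Γ Δ} → Ren Γ Δ → Tuple M Γ → Tuple M Δ → Set
    Agree {Γ} r ρ σ = ∀ {s} (x : s ∈ Γ) → lookup σ (r x) ≡ lookup ρ x

    agree-lift : ∀ {Γ Δ s} {r : Ren Γ Δ} {ρ σ} (a : Structure.Carrier M s) →
                 Agree r ρ σ → Agree (lift r) (a ∷ ρ) (a ∷ σ)
    agree-lift a ag (here refl) = refl
    agree-lift a ag (there x)   = ag x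

    agree-lift* : ∀ {xs Γ Δ} {r : Ren Γ Δ} {ρ σ} (a : Tuple M xs) →
                  Agree r ρ σ → Agree (lift* xs r) (append M a ρ) (append M a σ)
    agree-lift* []      ag = ag
    agree-lift* (a ∷ u) ag = agree-lift a (agree-lift* u ag)

    agree-++⁺ˡ : ∀ {ps qs} (b : Tuple M ps) (c : Tuple M qs) →
                 Agree (λ {s} → ++⁺ˡ {xs = ps} {ys = qs}) b (append M b c)
    agree-++⁺ˡ (a ∷ b) c (here refl) = refl
    agree-++⁺ˡ (a ∷ b) c (there x)   = agree-++⁺ˡ b c x

    agree-++⁺ʳ : ∀ {ps qs} (b : Tuple M ps) (c : Tuple M qs) →
                 Agree (++⁺ʳ ps) c (append M b c)
    agree-++⁺ʳ []      c x = refl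
    agree-++⁺ʳ (a ∷ b) c x = agree-++⁺ʳ b c x

  module Translation {P Q : Fragment Σ′} (P⊑Q : P ⊑ Q) where
    open _⊑_ P⊑Q
    module SP = Syntax P
    module SQ = Syntax Q

    mutual
      translateTerm : ∀ {Γ Δ s} → Ren Γ Δ → SP.Term Γ s → SQ.Term Δ s
      translateTerm r (SP.var x)      = SQ.var (r x)
      translateTerm r (SP.app f h ts) = SQ.app f (funs f h) (translateTerms r ts)

      translateTerms : ∀ {Γ Δ ss} → Ren Γ Δ → SP.Terms Γ ss → SQ.Terms Δ ss
      translateTerms r SP.[]         = SQ.[]
      translateTerms r (t SP.∷ ts) = translateTerm r t SQ.∷ translateTerms r ts

    translate : ∀ {Γ Δ} → Ren Γ Δ → SP.Formula Γ → SQ.Formula Δ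
    translate r SP.⊤′            = SQ.⊤′
    translate r SP.⊥′            = SQ.⊥′
    translate r (t SP.≐ u)       = translateTerm r t SQ.≐ translateTerm r u
    translate r (SP.rel R h ts)  = SQ.rel R (rels R h) (translateTerms r ts)
    translate r (SP.¬′ φ)        = SQ.¬′ translate r φ
    translate r (φ SP.∧′ ψ)      = translate r φ SQ.∧′ translate r ψ
    translate r (φ SP.∨′ ψ)      = translate r φ SQ.∨′ translate r ψ
    translate r (φ SP.⇒′ ψ)      = translate r φ SQ.⇒′ translate r ψ
    translate r (SP.∃′ s φ)      = SQ.∃′ s (translate (lift r) φ)
    translate r (SP.∀′ s φ)      = SQ.∀′ s (translate (lift r) φ)

    module _ (M : Structure Σ′) where
      open Structure M using (funI; relI)
      module EP = Sem M P
      module EQ = Sem M Q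

      mutual
        translateTerm-eval : ∀ {Γ Δ s} {r : Ren Γ Δ} {ρ σ} → Agree M r ρ σ →
                             (t : SP.Term Γ s) → EQ.evalT (translateTerm r t) σ ≡ EP.evalT t ρ
        translateTerm-eval ag (SP.var x)      = ag x
        translateTerm-eval ag (SP.app f h ts) = cong (funI f) (translateTerms-eval ag ts)

        translateTerms-eval : ∀ {Γ Δ ss} {r : Ren Γ Δ} {ρ σ} → Agree M r ρ σ →
                              (ts : SP.Terms Γ ss) → EQ.evalTs (translateTerms r ts) σ ≡ EP.evalTs ts ρ
        translateTerms-eval ag SP.[]         = refl
        translateTerms-eval ag (t SP.∷ ts) =
          cong₂ _∷_ (translateTerm-eval ag t) (translateTerms-eval ag ts)

      translate-sat : ∀ {Γ Δ} {r : Ren Γ Δ} {ρ σ} → Agree M r ρ σ →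
                      (φ : SP.Formula Γ) → EP.Sat φ ρ ⇔ EQ.Sat (translate r φ) σ
      translate-sat ag SP.⊤′ = ⇔.refl
      translate-sat ag SP.⊥′ = ⇔.refl
      translate-sat ag (t SP.≐ u) = mk⇔
        (λ e → trans (translateTerm-eval ag t) (trans e (sym (translateTerm-eval ag u))))
        (λ e → trans (sym (translateTerm-eval ag t)) (trans e (translateTerm-eval ag u)))
      translate-sat ag (SP.rel R h ts) = mk⇔
        (subst (relI R) (sym (translateTerms-eval ag ts)))
        (subst (relI R) (translateTerms-eval ag ts))
      translate-sat ag (SP.¬′ φ)   = ¬-cong-⇔ (translate-sat ag φ)
      translate-sat ag (φ SP.∧′ ψ) = translate-sat ag φ ×-⇔ translate-sat ag ψ
      translate-sat ag (φ SP.∨′ ψ) = translate-sat ag φ ⊎-⇔ translate-sat ag ψ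
      translate-sat ag (φ SP.⇒′ ψ) = →-cong-⇔ (translate-sat ag φ) (translate-sat ag ψ)
      translate-sat ag (SP.∃′ s φ) = mk⇔
        (λ (a , p) → a , to (translate-sat (agree-lift M a ag) φ) p)
        (λ (a , p) → a , from (translate-sat (agree-lift M a ag) φ) p)
      translate-sat ag (SP.∀′ s φ) = mk⇔
        (λ f a → to (translate-sat (agree-lift M a ag) φ) (f a))
        (λ f a → from (translate-sat (agree-lift M a ag) φ) (f a))

  module _ {M : Structure Σ′} where

    definable-⊑ : ∀ {P Q xs} {A : SubsetOf M xs} → P ⊑ Q →
                  Definable M P xs A → Definable M Q xs A
    definable-⊑ P⊑Q (ps , b , φ , h) =
      ps , b , translate (λ x → x) φ ,
      λ a → ⇔⇒pair (⇔.trans (pair⇒⇔ (h a)) (translate-sat M (λ _ → refl) φ))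
      where open Translation P⊑Q

    module _ {P : Fragment Σ′} {xs : List Sort} where
      open Syntax P
      open Sem M P using (Sat)
      open Translation (⊑-refl {P}) using (translate; translate-sat)
      open SetOperations M xs

      definable-⇔ : {A B : SubsetOf M xs} → (∀ a → A a ⇔ B a) →
                    Definable M P xs A → Definable M P xs B
      definable-⇔ e (ps , b , φ , h) =
        ps , b , φ , λ a → ⇔⇒pair (⇔.trans (⇔.sym (e a)) (pair⇒⇔ (h a)))

      definable-⊤ : Definable M P xs (λ _ → ⊤)
      definable-⊤ = [] , [] , ⊤′ , λ _ → (λ _ → tt) , (λ _ → tt)

      DefinedTogether : SubsetOf M xs → SubsetOf M xs → Set
      DefinedTogether A B =
        Σ (List Sort) λ ps → Σ (Tuple M ps) λ b → Σ (Formula (xs ++ ps)) λ φ → Σ (Formula (xs ++ ps)) λ ψ →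
          (∀ a → A a ⇔ Sat φ (append M a b)) × (∀ a → B a ⇔ Sat ψ (append M a b))

      definedTogether : {A B : SubsetOf M xs} → Definable M P xs A → Definable M P xs B →
                        DefinedTogether A B
      definedTogether (ps , b , φ , hφ) (qs , c , ψ , hψ) =
        ps ++ qs , append M b c ,
        translate (lift* xs ++⁺ˡ) φ , translate (lift* xs (++⁺ʳ ps)) ψ ,
        (λ a → ⇔.trans (pair⇒⇔ (hφ a)) (translate-sat M (agree-lift* M a (agree-++⁺ˡ M b c)) φ)) ,
        (λ a → ⇔.trans (pair⇒⇔ (hψ a)) (translate-sat M (agree-lift* M a (agree-++⁺ʳ M b c)) ψ))

      definable-∩ : {A B : SubsetOf M xs} → Definable M P xs A → Definable M P xs B →
                    Definable M P xs (A ∩ B)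
      definable-∩ dA dB with definedTogether dA dB
      ... | ps , b , φ , ψ , hA , hB = ps , b , φ ∧′ ψ , λ a → ⇔⇒pair (hA a ×-⇔ hB a)

      definable-∪ : {A B : SubsetOf M xs} → Definable M P xs A → Definable M P xs B →
                    Definable M P xs (_∪_ M A B)
      definable-∪ dA dB with definedTogether dA dB
      ... | ps , b , φ , ψ , hA , hB = ps , b , φ ∨′ ψ , λ a → ⇔⇒pair (hA a ⊎-⇔ hB a)

      definable-∖ : {A B : SubsetOf M xs} → Definable M P xs A → Definable M P xs B →
                    Definable M P xs (A ∖ B)
      definable-∖ dA dB with definedTogether dA dB
      ... | ps , b , φ , ψ , hA , hB =
        ps , b , φ ∧′ (¬′ ψ) , λ a → ⇔⇒pair (hA a ×-⇔ ¬-cong-⇔ (hB a))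

      definable-⋂ : {ι : Set} (K : List ι) (S : ι → SubsetOf M xs) →
                    (∀ i → i ∈ K → Definable M P xs (S i)) →
                    Definable M P xs (⋂ K S)
      definable-⋂ []      S dS = definable-⇔ (λ _ → mk⇔ (λ _ _ ()) (λ _ → tt)) definable-⊤
      definable-⋂ (k ∷ K) S dS =
        definable-⇔ (λ _ → mk⇔ (λ (s , f) → λ { i (here refl) → s ; i (there m) → f i m })
                                (λ g → g k (here refl) , λ i m → g i (there m)))
                    (definable-∩ (dS k (here refl)) (definable-⋂ K S (λ i m → dS i (there m))))

module _ (em : ExcludedMiddle 0ℓ) {Σ′ : Signature} {M : Structure Σ′} (R : OrdinalRank M)
         {xs : List (Signature.Sort Σ′)} where
  open Signature Σ′
  open OrdinalRank R
  open import Relation.Binary.Construct.Add.Infimum.Strict _<_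
    using (⊥₋<[_]; [_]; <₋-wellFounded; <₋-isStrictTotalOrder-≡) renaming (_<₋_ to _<ᵈ_)
  open import Relation.Binary.Construct.StrictToNonStrict _≡_ _<ᵈ_
    using (isPartialOrder) renaming (_≤_ to _≤ᵈ_)

  open SetOperations M xs

  Sub : Set₁
  Sub = SubsetOf M xs

  ≤ᵈ-antisym : ∀ {d e} → d ≤ᵈ e → e ≤ᵈ d → d ≡ e
  ≤ᵈ-antisym = IsPartialOrder.antisym
    (isPartialOrder (IsStrictTotalOrder.isStrictPartialOrder (<₋-isStrictTotalOrder-≡ isSTO)))

  ≤ᵈ-maxWithˡ : ∀ d e → d ≤ᵈ maxWith cmp d e
  ≤ᵈ-maxWithˡ nothing  nothing  = inj₂ refl
  ≤ᵈ-maxWithˡ nothing  (just y) = inj₁ ⊥₋<[ y ]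
  ≤ᵈ-maxWithˡ (just x) nothing  = inj₂ refl
  ≤ᵈ-maxWithˡ (just x) (just y) with cmp x y
  ... | tri< x<y _ _ = inj₁ [ x<y ]
  ... | tri≈ _ _ _   = inj₂ refl
  ... | tri> _ _ _   = inj₂ refl

  maxWith-sel : ∀ d e → maxWith cmp d e ≡ d ⊎ maxWith cmp d e ≡ e
  maxWith-sel nothing  e        = inj₂ refl
  maxWith-sel (just x) nothing  = inj₁ refl
  maxWith-sel (just x) (just y) with cmp x y
  ... | tri< _ _ _ = inj₂ refl
  ... | tri≈ _ _ _ = inj₁ refl
  ... | tri> _ _ _ = inj₁ refl

  dim-split : ∀ {A B : Sub} (dA : Def∩ M xs A) (dB : Def∩ M xs B) →
              dim A dA ≡ maxWith cmp (dim (A ∩ B) (definable-∩ dA dB)) (dim (A ∖ B) (definable-∖ dA dB))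
  dim-split {A} {B} dA dB =
    trans (dim-ext A _ dA (definable-∪ (definable-∩ dA dB) (definable-∖ dA dB))
                   (λ a → (λ x → cases x em) , λ { (inj₁ (x , _)) → x ; (inj₂ (x , _)) → x }))
          (dim-∪ _ _ _ _ _)
    where
    cases : ∀ {a} → A a → Dec (B a) → (A ∩ B) a ⊎ (A ∖ B) a
    cases x (yes b) = inj₁ (x , b)
    cases x (no ¬b) = inj₂ (x , ¬b)

  dim-mono : ∀ {A B : Sub} (dA : Def∩ M xs A) (dB : Def∩ M xs B) → _⊆_ M A B →
             dim A dA ≤ᵈ dim B dB
  dim-mono {A} {B} dA dB A⊆B =
    subst₂ _≤ᵈ_ (dim-ext (B ∩ A) A _ dA (λ a → proj₂ , λ x → A⊆B a x , x))
                (sym (dim-split dB dA))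
                (≤ᵈ-maxWithˡ _ _)

  dim-sandwich : ∀ {A B C : Sub} (dA : Def∩ M xs A) (dB : Def∩ M xs B) (dC : Def∩ M xs C) →
                 _⊆_ M A B → _⊆_ M B C → dim A dA ≡ dim C dC → dim B dB ≡ dim C dC
  dim-sandwich dA dB dC A⊆B B⊆C A≡C =
    ≤ᵈ-antisym (dim-mono dB dC B⊆C) (subst (_≤ᵈ dim _ dB) A≡C (dim-mono dA dB A⊆B))

  nonempty⇒dim≢−∞ : ∀ {A : Sub} (dA : Def∩ M xs A) → Nonempty M A → dim A dA ≢ nothing
  nonempty⇒dim≢−∞ dA (a , x) d≡−∞ = proj₁ (dim-−∞ _ dA) d≡−∞ a x

  -- W can be neither empty (its rank would be −∞) nor nonempty (it would meet P).
  dim-avoiding-pseudoDense : ∀ {P V W : Sub} (dV : Def∩ M xs V) (dW : Def∩ M xs W) →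
                             PseudoDense R P V dV → Nonempty M V → _⊆_ M W V →
                             (∀ a → W a → ¬ P a) → dim W dW ≢ dim V dV
  dim-avoiding-pseudoDense {W = W} dV dW pd neV W⊆V W∩P=∅ W≡V = ¬¬nonemptyW nonempty-contra
    where
    nonempty-contra : ¬ Nonempty M W
    nonempty-contra neW with pd _ dW W⊆V neW W≡V
    ... | a , p , w = W∩P=∅ a w p
    ¬¬nonemptyW : ¬ ¬ Nonempty M W
    ¬¬nonemptyW ¬neW =
      nonempty⇒dim≢−∞ dV neV (trans (sym W≡V) (proj₂ (dim-−∞ _ dW) λ a w → ¬neW (a , w)))

  dim-∩-full : ∀ {P V Z S : Sub} (dV : Def∩ M xs V) (dZ : Def∩ M xs Z) (dS : Def∩ M xs S) →
               PseudoDense R P V dV → Nonempty M V → _⊆_ M Z V → dim Z dZ ≡ dim V dV →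
               (∀ a → Z a → P a → S a) → dim (Z ∩ S) (definable-∩ dZ dS) ≡ dim V dV
  dim-∩-full dV dZ dS pd neV Z⊆V Z≡V Z∩P⊆S
    with maxWith-sel (dim _ (definable-∩ dZ dS)) (dim _ (definable-∖ dZ dS))
  ... | inj₁ e = trans (sym (trans (dim-split dZ dS) e)) Z≡V
  ... | inj₂ e = ⊥-elim (dim-avoiding-pseudoDense dV (definable-∖ dZ dS) pd neV
                           (λ a (z , _) → Z⊆V a z) (λ a (z , ¬s) p → ¬s (Z∩P⊆S a z p))
                           (trans (sym (trans (dim-split dZ dS) e)) Z≡V))

  JointlyPseudoDense : List I → (I → Sub) → Set₁
  JointlyPseudoDense J X =
    Σ Sub λ Y → Σ (Def∩ M xs Y) λ dY → Nonempty M Y × (∀ i → i ∈ J → PseudoDense R (X i) Y dY)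

  module _ (X : I → Sub) {Y : Sub} (dY : Def∩ M xs Y) (neY : Nonempty M Y) (S : I → Sub) where

    DenseInsideSeparator : I → Set₁
    DenseInsideSeparator i = Def∩ M xs (S i) × PseudoDense R (X i) Y dY × _⊆_ M (X i) (S i)

    full-dim-meets-⋂ : ∀ {K} → All DenseInsideSeparator K →
                       ∀ {Z} (dZ : Def∩ M xs Z) → _⊆_ M Z Y → dim Z dZ ≡ dim Y dY →
                       ¬ Empty M (Z ∩ ⋂ K S)
    full-dim-meets-⋂ [] dZ Z⊆Y Z≡Y empty =
      nonempty⇒dim≢−∞ dY neY (trans (sym Z≡Y) (proj₂ (dim-−∞ _ dZ) λ a z → empty a (z , λ _ ())))
    full-dim-meets-⋂ ((dSk , pdk , Xk⊆Sk) ∷ rest) dZ Z⊆Y Z≡Y empty =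
      full-dim-meets-⋂ rest (definable-∩ dZ dSk) (λ a (z , _) → Z⊆Y a z)
        (dim-∩-full dY dZ dSk pdk neY Z⊆Y Z≡Y (λ a _ x → Xk⊆Sk a x))
        (λ a ((z , s) , f) → empty a (z , λ { i (here refl) → s ; i (there m) → f i m }))

  jointlyPseudoDense⇒¬separated : ∀ J X → JointlyPseudoDense J X → ¬ Separated M J X
  jointlyPseudoDense⇒¬separated J X (Y , dY , neY , pd) (S , dS , X⊆S , empty) =
    full-dim-meets-⋂ X dY neY S (tabulate λ {i} m → dS i m , pd i m , X⊆S i m)
      dY (λ _ y → y) refl (λ a (_ , s) → empty a s)

  module _ (J : List I) (X : I → Sub) (dX : ∀ i → i ∈ J → Defᵢ M i xs (X i))
           (approximable : ∀ i → i ∈ J → Approximable R i) where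

    SeparatedWithin : Sub → Set₁
    SeparatedWithin Z =
      Σ (I → Sub) λ D → (∀ i → i ∈ J → Def∩ M xs (D i)) ×
                        (∀ i → i ∈ J → _⊆_ M (X i ∩ Z) (D i)) ×
                        Empty M (Z ∩ ⋂ J D)

    empty⇒separatedWithin : ∀ {Z} → Empty M Z → SeparatedWithin Z
    empty⇒separatedWithin empty =
      (λ _ _ → ⊤) , (λ _ _ → definable-⊤) , (λ _ _ _ _ → tt) , λ a (z , _) → empty a z

    module Refinement {Z : Sub} (dZ : Def∩ M xs Z) where

      -- Outside J the closure is junk (everything); only its values on J are used.
      closure : I → Sub
      closure i with em {i ∈ J}
      ... | yes m = proj₁ (approximable i m (X i ∩ Z) (definable-∩ (dX i m) (definable-⊑ (L∩⊑Lᵢ i) dZ)))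
      ... | no _  = λ _ → ⊤

      closure-pseudoClosure : ∀ i → i ∈ J →
                              Σ (Def∩ M xs (closure i)) λ dV → PseudoClosure R (X i ∩ Z) (closure i) dV
      closure-pseudoClosure i m with em {i ∈ J}
      ... | yes m′ = proj₂ (approximable i m′ (X i ∩ Z) (definable-∩ (dX i m′) (definable-⊑ (L∩⊑Lᵢ i) dZ)))
      ... | no ¬m  = ⊥-elim (¬m m)

      C : Sub
      C = Z ∩ ⋂ J closure

      dC : Def∩ M xs C
      dC = definable-∩ dZ (definable-⋂ J closure λ i m → proj₁ (closure-pseudoClosure i m))

      -- Inside C keep the given separators, outside C use the pseudo-closures.
      separatedWithin-extend : SeparatedWithin C → SeparatedWithin Z
      separatedWithin-extend (D , dD , X∩C⊆D , empty) = D′ , dD′ , X∩Z⊆D′ , empty′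
        where
        D′ : I → Sub
        D′ i = _∪_ M (D i ∩ C) (closure i ∖ C)

        dD′ : ∀ i → i ∈ J → Def∩ M xs (D′ i)
        dD′ i m = definable-∪ (definable-∩ (dD i m) dC) (definable-∖ (proj₁ (closure-pseudoClosure i m)) dC)

        X∩Z⊆D′ : ∀ i → i ∈ J → _⊆_ M (X i ∩ Z) (D′ i)
        X∩Z⊆D′ i m a (x , z) with em {C a}
        ... | yes c = inj₁ (X∩C⊆D i m a (x , z , proj₂ c) , c)
        ... | no ¬c = inj₂ (proj₁ (proj₂ (closure-pseudoClosure i m)) a (x , z) , ¬c)

        empty′ : Empty M (Z ∩ ⋂ J D′)
        empty′ a (z , inD′) with em {C a}
        ... | yes c = empty a (c , λ i m → inside (inD′ i m))
          where
          inside : ∀ {i} → D′ i a → D i a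
          inside (inj₁ (d , _))  = d
          inside (inj₂ (_ , ¬c)) = ⊥-elim (¬c c)
        ... | no ¬c = ¬c (z , λ i m → outside (inD′ i m))
          where
          outside : ∀ {i} → D′ i a → closure i a
          outside (inj₁ (_ , c)) = ⊥-elim (¬c c)
          outside (inj₂ (v , _)) = v

      pseudoDense-refinement : Nonempty M C → dim C dC ≡ dim Z dZ →
                               ∀ i → i ∈ J → PseudoDense R (X i) C dC
      pseudoDense-refinement (c , z , inV) C≡Z i m X′ dX′ X′⊆C neX′ X′≡C
        with closure-pseudoClosure i m
      ... | dV , _ , pdV with pdV X′ dX′ (λ a x′ → proj₂ (X′⊆C a x′) i m) neX′ (trans X′≡C C≡V)
        where
        V∩Z≡V : dim (closure i ∩ Z) (definable-∩ dV dZ) ≡ dim (closure i) dV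
        V∩Z≡V = dim-∩-full dV dV dZ pdV (c , inV i m) (λ _ v → v) refl (λ _ _ (_ , z) → z)
        V∩Z≡Z : dim (closure i ∩ Z) (definable-∩ dV dZ) ≡ dim Z dZ
        V∩Z≡Z = dim-sandwich dC (definable-∩ dV dZ) dZ (λ a (z , inV) → inV i m , z) (λ _ → proj₂) C≡Z
        C≡V : dim C dC ≡ dim (closure i) dV
        C≡V = trans C≡Z (trans (sym V∩Z≡Z) V∩Z≡V)
      ... | a , (x , _) , x′ = a , x , x′

    refine : ∀ {Z} (dZ : Def∩ M xs Z) → Acc _<ᵈ_ (dim Z dZ) → ¬ SeparatedWithin Z →
             JointlyPseudoDense J X
    refine {Z} dZ (acc smaller) ¬sepZ = conclude (dim-mono dC dZ λ _ → proj₁)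
      where
      open Refinement dZ

      ¬sepC : ¬ SeparatedWithin C
      ¬sepC sep = ¬sepZ (separatedWithin-extend sep)

      neC : Nonempty M C
      neC with em {Nonempty M C}
      ... | yes ne = ne
      ... | no ¬ne = ⊥-elim (¬sepC (empty⇒separatedWithin λ a c → ¬ne (a , c)))

      conclude : dim C dC ≤ᵈ dim Z dZ → JointlyPseudoDense J X
      conclude (inj₁ C<Z) = refine dC (smaller C<Z) ¬sepC
      conclude (inj₂ C≡Z) = C , dC , neC , pseudoDense-refinement neC C≡Z

    ¬separated⇒jointlyPseudoDense : ¬ Separated M J X → JointlyPseudoDense J X
    ¬separated⇒jointlyPseudoDense ¬sep =
      refine definable-⊤ (<₋-wellFounded wf _) λ (D , dD , X⊆D , empty) →
        ¬sep (D , dD , (λ i m a x → X⊆D i m a (x , tt)) , λ a f → empty a (tt , f))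

proposition5p2 :
  ExcludedMiddle 0ℓ →
  (Σ′ : Signature) (M : Structure Σ′) (R : OrdinalRank M)
  (xs : List (Signature.Sort Σ′)) (J : List (Signature.I Σ′))
  (X : Signature.I Σ′ → SubsetOf M xs) →
  (∀ i → i ∈ J → Defᵢ M i xs (X i)) →
  ((Σ (SubsetOf M xs) λ Y → Σ (Def∩ M xs Y) λ dY →
      Nonempty M Y × (∀ i → i ∈ J → PseudoDense R (X i) Y dY))
    → ¬ Separated M J X)
  ×
  ((∀ i → i ∈ J → Approximable R i) →
   ¬ Separated M J X →
   Σ (SubsetOf M xs) λ Y → Σ (Def∩ M xs Y) λ dY →
     Nonempty M Y × (∀ i → i ∈ J → PseudoDense R (X i) Y dY))
proposition5p2 em Σ′ M R xs J X dX =
  jointlyPseudoDense⇒¬separated em R J X ,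
  ¬separated⇒jointlyPseudoDense em R J X dX
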